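{- Let $G$ be a finite connected graph with spanning tree $T_0$, let the edges of $T_0$ be directed and labeled $\vec f_1,\dots,\vec f_M$, and let the edges of $G-T_0$ be directed. Then the mesh Laplacian $\Delta(G,T_0)=YY^t$ (an $M\times M$ matrix indexed by the $\vec f_k$) is given by $$(YY^t)_{\vec f_k,\vec f_k}=\#\{e\in E(G-T_0): f_k \text{ is in the support of } D(\vec e)\},$$ and for $k\neq l$, $$(YY^t)_{\vec f_k,\vec f_l}=Sign(k,l)\cdot\#\{e\in E(G-T_0): f_k \text{ and } f_l \text{ are both in the support of } D(\vec e)\},$$ where $Sign(k,l)=\langle \vec f_k,\vec\gamma\rangle\cdot\langle\vec f_l,\vec\gamma\rangle\in\{\pm1\}$, with $\vec\gamma$ the unique directed path in $T_0$ from the edge $f_k$ to the edge $f_l$ (containing both edges), viewed as a 1-chain.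
   Context: For a directed edge $\vec e$ of $G-T_0$ from $P$ to $Q$: $D(\vec e)=0$ if $P=Q$, and otherwise $D(\vec e)\in C_1(T_0;\mathbb{R})$ is the sum of the edges of the unique simple path in $T_0$ from $Q$ to $P$, each oriented along the path (written in the basis $\vec f_k$ with coefficients $0,\pm1$). $Y$ is the $|E(T_0)|\times|E(G-T_0)|$ matrix of $D$. $\langle\cdot,\cdot\rangle$ is the standard inner product on 1-chains with directed edges orthonormal. -}

module Defs where

open import Data.Nat using (ℕ)
open import Data.Fin using (Fin)
open import Data.Fin.Properties using () renaming (_≟_ to _≟ᶠ_)
open import Data.Bool using (Bool; true; false)
open import Data.Integer using (ℤ; +_; -_; _+_; _*_; 0ℤ; 1ℤ)
import Data.Integer as ℤ
open import Data.List using (List; []; _∷_; map; filter; length; foldr; allFin)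
open import Data.List.Relation.Unary.Unique.Propositional using (Unique)
open import Data.Product using (_×_; _,_; proj₁; proj₂; ∃)
open import Relation.Binary.PropositionalEquality using (_≡_)
open import Relation.Nullary using (¬_; yes; no)
open import Relation.Nullary.Decidable using (¬?; _×-dec_)

-- A finite (multi)graph on vertex set Fin n whose edges are directed:
-- an edge is given by its (tail , head).
EdgeSet : ℕ → ℕ → Set
EdgeSet n m = Fin m → Fin n × Fin n

-- An oriented edge of an edge set: (edge index , true = along its direction,
-- false = against it).  A 1-chain built from a walk is a list of these.
OEdge : ℕ → Set
OEdge m = Fin m × Bool

module _ {n m : ℕ} (T : EdgeSet n m) where

  start : OEdge m → Fin n
  start (i , true)  = proj₁ (T i)
  start (i , false) = proj₂ (T i)

  end : OEdge m → Fin n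
  end (i , true)  = proj₂ (T i)
  end (i , false) = proj₁ (T i)

  data Walk : Fin n → Fin n → List (OEdge m) → Set where
    nil  : ∀ {u} → Walk u u []
    cons : ∀ {u v d ds} → start d ≡ u → Walk (end d) v ds → Walk u v (d ∷ ds)

  laterVerts : List (OEdge m) → List (Fin n)
  laterVerts = map end

  SimplePath : Fin n → Fin n → List (OEdge m) → Set
  SimplePath u v ds = Walk u v ds × Unique (u ∷ laterVerts ds)

  data NonEmpty {A : Set} : List A → Set where
    nonEmpty : ∀ {x xs} → NonEmpty (x ∷ xs)

  Cycle : List (OEdge m) → Set
  Cycle ds = ∃ λ u → Walk u u ds × NonEmpty ds
                     × Unique (map proj₁ ds) × Unique (laterVerts ds)

  Connected : Set
  Connected = ∀ u v → ∃ λ ds → Walk u v ds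

  Acyclic : Set
  Acyclic = ∀ ds → ¬ Cycle ds

  -- T is a tree on all of Fin n, i.e. a spanning tree of any graph containing it
  IsSpanningTree : Set
  IsSpanningTree = Connected × Acyclic

coef : ∀ {m} → Fin m → List (OEdge m) → ℤ
coef k [] = 0ℤ
coef k ((i , b) ∷ ds) with k ≟ᶠ i
... | no _ = coef k ds
... | yes _ with b
...   | true  = 1ℤ + coef k ds
...   | false = (- 1ℤ) + coef k ds

sumFin : ∀ {N} → (Fin N → ℤ) → ℤ
sumFin {N} f = foldr _+_ 0ℤ (map f (allFin N))

countSupp : ∀ {M N} → (Fin N → List (OEdge M)) → Fin M → ℕ
countSupp {N = N} D k =
  length (filter (λ e → ¬? (coef k (D e) ℤ.≟ 0ℤ)) (allFin N))

countSupp₂ : ∀ {M N} → (Fin N → List (OEdge M)) → Fin M → Fin M → ℕ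
countSupp₂ {N = N} D k l =
  length (filter (λ e → ¬? (coef k (D e) ℤ.≟ 0ℤ) ×-dec ¬? (coef l (D e) ℤ.≟ 0ℤ))
                 (allFin N))

-- Y is the M × N matrix with Y k e = coefficient of f_k in D(e);
-- (Y Yᵗ)_{k,l} = Σ_e Y k e * Y l e
YYt : ∀ {M N} → (Fin N → List (OEdge M)) → Fin M → Fin M → ℤ
YYt D k l = sumFin (λ e → coef k (D e) * coef l (D e))

data FirstEdge {m : ℕ} (k : Fin m) : List (OEdge m) → Set where
  first : ∀ {b ds} → FirstEdge k ((k , b) ∷ ds)

data LastEdge {m : ℕ} (l : Fin m) : List (OEdge m) → Set where
  last  : ∀ {b} → LastEdge l ((l , b) ∷ [])
  later : ∀ {d ds} → LastEdge l ds → LastEdge l (d ∷ ds)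

PathFromEdgeToEdge : ∀ {n m} → EdgeSet n m → Fin m → Fin m → List (OEdge m) → Set
PathFromEdgeToEdge T k l γ =
  ∃ λ u → ∃ λ v → SimplePath T u v γ × FirstEdge k γ × LastEdge l γ

Sign : ∀ {m} → Fin m → Fin m → List (OEdge m) → ℤ
Sign k l γ = coef k γ * coef l γ

-- Each D(e) is a simple path, so it uses every edge of T₀ at most once and its
-- coefficients lie in {0, ±1}; this gives the diagonal. Off the diagonal, if D(e) contains
-- f_k and f_l, the part of D(e) from one of them to the other is a simple path of T₀
-- joining the two edges. In a tree such a path is unique (two distinct simple paths with
-- the same ends, cut where they first meet again, bound a cycle), so that part is γ or
-- its reverse, and the product of the coefficients of f_k and f_l in D(e) is Sign(k,l).
module Submission where

open import Defs
open import Data.Nat using (ℕ)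
open import Data.Fin using (Fin)
open import Data.Fin.Properties using () renaming (_≟_ to _≟ᶠ_)
open import Data.Bool using (Bool; true; false; not)
open import Data.Bool.Properties using (not-injective) renaming (_≟_ to _≟ᵇ_)
open import Data.Integer using (ℤ; +_; -_; _+_; _*_; 0ℤ; 1ℤ)
import Data.Integer as ℤ
open import Data.Integer.Properties
  using (+-identityˡ; +-identityʳ; *-identityˡ; *-zeroʳ; *-suc)
open import Data.List
  using (List; []; _∷_; _++_; _∷ʳ_; map; filter; length; foldr; reverse; allFin)
open import Data.List.Properties
  using (map-++; map-∘; ++-assoc; ∷ʳ-++; ++-conicalʳ; unfold-reverse; reverse-++; reverse-map)
open import Data.List.Relation.Unary.All as All using (All; []; _∷_)
import Data.List.Relation.Unary.All.Properties as All
open import Data.List.Relation.Unary.Any using (Any; here; there)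
import Data.List.Relation.Unary.Any.Properties as Any
import Data.List.Relation.Unary.First as First
import Data.List.Relation.Unary.First.Properties as First
import Data.List.Relation.Unary.AllPairs as AllPairs
open import Data.List.Relation.Unary.Unique.Propositional using (Unique; []; _∷_)
open import Data.List.Relation.Unary.Unique.Propositional.Properties using (Unique[x∷xs]⇒x∉xs)
import Data.List.Relation.Unary.Unique.Propositional.Properties as Unique
open import Data.List.Relation.Binary.Disjoint.Propositional using (Disjoint)
import Data.List.Relation.Binary.Permutation.Setoid as Permutation
import Data.List.Relation.Binary.Permutation.Setoid.Properties as Permutation
open import Data.List.Membership.Propositional using (_∈_; _∉_; lose)
import Data.List.Membership.DecPropositional as DecMembership
open import Data.List.Membership.Propositional.Properties
  using (∈-map⁺; ∈-map⁻; ∈-++⁺ˡ; ∈-++⁺ʳ; ∈-++⁻; ∈-∃++)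
open import Data.Product using (_×_; _,_; proj₁; proj₂; ∃; ∃₂; uncurry)
open import Data.Product.Properties using (≡-dec)
open import Data.Sum using (_⊎_; inj₁; inj₂)
import Data.Sum as Sum
open import Data.Empty using (⊥-elim)
open import Function using (_∘_; case_of_)
open import Relation.Binary.PropositionalEquality
  using (_≡_; _≢_; refl; sym; trans; cong; cong₂; subst; subst₂; setoid; module ≡-Reasoning)
open import Relation.Nullary using (¬_; yes; no; Dec)
open import Relation.Nullary.Decidable using (toSum)
open import Relation.Unary using (Pred; Decidable)
open import Level using (0ℓ)

module _ {A : Set} where

  Unique-++⁻ : ∀ (xs : List A) {ys} → Unique (xs ++ ys) → Unique xs × Unique ys × Disjoint xs ys
  Unique-++⁻ [] u = [] , u , λ ()
  Unique-++⁻ (x ∷ xs) (x∉ ∷ u) with Unique-++⁻ xs u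
  ... | uxs , uys , disjoint =
    All.++⁻ˡ xs x∉ ∷ uxs , uys ,
    λ { (here refl , x∈ys) → All.lookup (All.++⁻ʳ xs x∉) x∈ys refl
      ; (there z∈xs , z∈ys) → disjoint (z∈xs , z∈ys) }

  Unique-reverse : ∀ {xs : List A} → Unique xs → Unique (reverse xs)
  Unique-reverse {xs} = Permutation.Unique-resp-↭ (setoid A)
    (Permutation.↭-sym (setoid A) (Permutation.↭-reverse (setoid A) xs))

  ∈-∈-∃++ : ∀ {x y : A} {xs} → x ∈ xs → y ∈ xs → x ≢ y
    → (∃₂ λ a q → ∃ λ r → xs ≡ a ++ (x ∷ q ∷ʳ y) ++ r)
    ⊎ (∃₂ λ a q → ∃ λ r → xs ≡ a ++ (y ∷ q ∷ʳ x) ++ r)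
  ∈-∈-∃++ (here refl) (here refl) x≢y = ⊥-elim (x≢y refl)
  ∈-∈-∃++ {y = y} (here refl) (there y∈) _ with ∈-∃++ y∈
  ... | q , r , refl = inj₁ ([] , q , r , cong (_ ∷_) (sym (++-assoc q (y ∷ []) r)))
  ∈-∈-∃++ {x = x} (there x∈) (here refl) _ with ∈-∃++ x∈
  ... | q , r , refl = inj₂ ([] , q , r , cong (_ ∷_) (sym (++-assoc q (x ∷ []) r)))
  ∈-∈-∃++ {x} {y} {z ∷ _} (there x∈) (there y∈) x≢y =
    Sum.map (prepend λ q → x ∷ q ∷ʳ y) (prepend λ q → y ∷ q ∷ʳ x) (∈-∈-∃++ x∈ y∈ x≢y)
    where
    prepend : ∀ {zs} (s : List A → List A)
      → (∃₂ λ a q → ∃ λ r → zs ≡ a ++ s q ++ r) → ∃₂ λ a q → ∃ λ r → z ∷ zs ≡ a ++ s q ++ r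
    prepend _ (a , q , r , eq) = z ∷ a , q , r , cong (z ∷_) eq

  first-∃++ : ∀ {P : Pred A 0ℓ} → Decidable P → ∀ {xs} → Any P xs
    → ∃₂ λ a x → ∃ λ r → xs ≡ a ++ x ∷ r × All (¬_ ∘ P) a × P x
  first-∃++ P? {xs} any with First.first (Sum.swap ∘ toSum ∘ P?) xs
  ... | inj₂ none = ⊥-elim (All.All¬⇒¬Any none any)
  ... | inj₁ hit with First.toView hit
  ...   | none First.++ px ∷ r = _ , _ , r , refl , none , px

  ∷-≡-++-head : ∀ {x y : A} {xs ys} a {r s} → x ∷ xs ≡ a ++ r → y ∷ ys ≡ a ++ s → a ≢ [] → x ≡ y
  ∷-≡-++-head []      _    _    a≢[] = ⊥-elim (a≢[] refl)
  ∷-≡-++-head (_ ∷ _) refl refl _    = refl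

sum-indicator : ∀ {A : Set} {P : Pred A 0ℓ} (P? : Decidable P) (g : A → ℤ) (s : ℤ)
  → (∀ x → P x → g x ≡ s) → (∀ x → ¬ P x → g x ≡ 0ℤ)
  → ∀ xs → foldr _+_ 0ℤ (map g xs) ≡ s * + length (filter P? xs)
sum-indicator P? g s onP offP [] = sym (*-zeroʳ s)
sum-indicator P? g s onP offP (x ∷ xs) with P? x
... | yes p = trans (cong₂ _+_ (onP x p) (sum-indicator P? g s onP offP xs))
                    (sym (*-suc s (+ length (filter P? xs))))
... | no ¬p = trans (cong₂ _+_ (offP x ¬p) (sum-indicator P? g s onP offP xs))
                    (+-identityˡ _)

sgn : Bool → ℤ
sgn true  = 1ℤ
sgn false = - 1ℤ

sgn-square : ∀ b → sgn b * sgn b ≡ 1ℤ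
sgn-square true  = refl
sgn-square false = refl

sgn-not-* : ∀ b c → sgn (not b) * sgn (not c) ≡ sgn b * sgn c
sgn-not-* true  true  = refl
sgn-not-* true  false = refl
sgn-not-* false true  = refl
sgn-not-* false false = refl

product-≡0 : ∀ x y → ¬ (x ≢ 0ℤ × y ≢ 0ℤ) → x * y ≡ 0ℤ
product-≡0 x y ¬both with x ℤ.≟ 0ℤ | y ℤ.≟ 0ℤ
... | yes refl | _        = refl
... | no _     | yes refl = *-zeroʳ x
... | no x≢0   | no y≢0   = ⊥-elim (¬both (x≢0 , y≢0))

module _ {m : ℕ} {k : Fin m} where

  coef-head : ∀ b ds → coef k ((k , b) ∷ ds) ≡ sgn b + coef k ds
  coef-head b ds with k ≟ᶠ k
  ... | no k≢k = ⊥-elim (k≢k refl)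
  ... | yes _ with b
  ...   | true  = refl
  ...   | false = refl

  coef-other : ∀ {i} b ds → k ≢ i → coef k ((i , b) ∷ ds) ≡ coef k ds
  coef-other {i} b ds k≢i with k ≟ᶠ i
  ... | yes k≡i = ⊥-elim (k≢i k≡i)
  ... | no _    = refl

  coef-∉ : ∀ ds → k ∉ map proj₁ ds → coef k ds ≡ 0ℤ
  coef-∉ []             _  = refl
  coef-∉ ((i , b) ∷ ds) k∉ = trans (coef-other b ds (k∉ ∘ here)) (coef-∉ ds (k∉ ∘ there))

  coef-∈ : ∀ {b} ds → Unique (map proj₁ ds) → (k , b) ∈ ds → coef k ds ≡ sgn b
  coef-∈ {b} ((_ , _) ∷ ds) (k∉ ∷ _) (here refl) = begin
    coef k ((k , b) ∷ ds)  ≡⟨ coef-head b ds ⟩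
    sgn b + coef k ds      ≡⟨ cong (λ z → sgn b + z) (coef-∉ ds (λ k∈ → All.lookup k∉ k∈ refl)) ⟩
    sgn b + 0ℤ             ≡⟨ +-identityʳ (sgn b) ⟩
    sgn b                  ∎
    where open ≡-Reasoning
  coef-∈ ((i , b') ∷ ds) (i∉ ∷ unique) (there kb∈) =
    trans (coef-other b' ds k≢i) (coef-∈ ds unique kb∈)
    where
    k≢i : k ≢ i
    k≢i refl = All.lookup i∉ (∈-map⁺ proj₁ kb∈) refl

  coef≢0⇒∈ : ∀ ds → coef k ds ≢ 0ℤ → ∃ λ b → (k , b) ∈ ds
  coef≢0⇒∈ []             coef≢0 = ⊥-elim (coef≢0 refl)
  coef≢0⇒∈ ((i , b) ∷ ds) coef≢0 with k ≟ᶠ i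
  ... | yes refl = b , here refl
  ... | no _ with coef≢0⇒∈ ds coef≢0
  ...   | b' , kb∈ = b' , there kb∈

LastEdge⇒∷ʳ : ∀ {m} {l : Fin m} {xs} → LastEdge l xs → ∃₂ λ c ys → xs ≡ ys ∷ʳ (l , c)
LastEdge⇒∷ʳ (last {c})    = c , [] , refl
LastEdge⇒∷ʳ (later {d} l∈) with LastEdge⇒∷ʳ l∈
... | c , ys , refl = c , d ∷ ys , refl

module Paths {n m : ℕ} (T : EdgeSet n m) where

  open DecMembership (_≟ᶠ_ {n}) using (_∈?_)

  flip : OEdge m → OEdge m
  flip d = proj₁ d , not (proj₂ d)

  reversePath : List (OEdge m) → List (OEdge m)
  reversePath p = reverse (map flip p)

  _≟ₑ_ : (d d' : OEdge m) → Dec (d ≡ d')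
  _≟ₑ_ = ≡-dec _≟ᶠ_ _≟ᵇ_

  vertices : Fin n → List (OEdge m) → List (Fin n)
  vertices u p = u ∷ laterVerts T p

  Incident : Fin n → Fin m → Set
  Incident z i = z ≡ proj₁ (T i) ⊎ z ≡ proj₂ (T i)

  start-flip : ∀ d → start T (flip d) ≡ end T d
  start-flip (_ , true)  = refl
  start-flip (_ , false) = refl

  end-flip : ∀ d → end T (flip d) ≡ start T d
  end-flip (_ , true)  = refl
  end-flip (_ , false) = refl

  start-incident : ∀ d → Incident (start T d) (proj₁ d)
  start-incident (_ , true)  = inj₁ refl
  start-incident (_ , false) = inj₂ refl

  end-incident : ∀ d → Incident (end T d) (proj₁ d)
  end-incident (_ , true)  = inj₂ refl
  end-incident (_ , false) = inj₁ refl

  incident⇒start⊎end : ∀ {z} d → Incident z (proj₁ d) → z ≡ start T d ⊎ z ≡ end T d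
  incident⇒start⊎end (_ , true)  = λ inc → inc
  incident⇒start⊎end (_ , false) = Sum.swap

  same-index-same-start : ∀ {f g} → proj₁ f ≡ proj₁ g → start T f ≡ start T g
    → start T f ≢ end T f → f ≡ g
  same-index-same-start {_ , true}  {_ , true}  refl _   _        = refl
  same-index-same-start {_ , false} {_ , false} refl _   _        = refl
  same-index-same-start {_ , true}  {_ , false} refl s≡s loopFree = ⊥-elim (loopFree s≡s)
  same-index-same-start {_ , false} {_ , true}  refl s≡s loopFree = ⊥-elim (loopFree s≡s)

  indices-reversePath : ∀ p → map proj₁ (reversePath p) ≡ reverse (map proj₁ p)
  indices-reversePath p = trans (reverse-map proj₁ (map flip p)) (cong reverse (sym (map-∘ p)))

  reversePath-∷-∷ʳ : ∀ d q e → reversePath (d ∷ q ∷ʳ e) ≡ flip e ∷ reversePath q ∷ʳ flip d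
  reversePath-∷-∷ʳ d q e = begin
    reverse (flip d ∷ map flip (q ∷ʳ e))
      ≡⟨ cong (λ z → reverse (flip d ∷ z)) (map-++ flip q (e ∷ [])) ⟩
    reverse (flip d ∷ map flip q ∷ʳ flip e)
      ≡⟨ unfold-reverse (flip d) (map flip q ∷ʳ flip e) ⟩
    reverse (map flip q ∷ʳ flip e) ∷ʳ flip d
      ≡⟨ cong (_∷ʳ flip d) (reverse-++ (map flip q) (flip e ∷ [])) ⟩
    flip e ∷ reversePath q ∷ʳ flip d
      ∎
    where open ≡-Reasoning

  walk-single : ∀ {u v} d → start T d ≡ u → end T d ≡ v → Walk T u v (d ∷ [])
  walk-single d refl refl = cons refl nil

  walk-start : ∀ {u v d ds} → Walk T u v (d ∷ ds) → start T d ≡ u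
  walk-start (cons s≡u _) = s≡u

  walk-++ : ∀ {u v w p q} → Walk T u v p → Walk T v w q → Walk T u w (p ++ q)
  walk-++ nil          wq = wq
  walk-++ (cons s≡u w) wq = cons s≡u (walk-++ w wq)

  walk-++⁻ : ∀ p {q u w} → Walk T u w (p ++ q) → ∃ λ v → Walk T u v p × Walk T v w q
  walk-++⁻ []      wq = _ , nil , wq
  walk-++⁻ (_ ∷ p) (cons s≡u w) with walk-++⁻ p w
  ... | v , wp , wq = v , cons s≡u wp , wq

  walk-reverse : ∀ {u v p} → Walk T u v p → Walk T v u (reversePath p)
  walk-reverse nil = nil
  walk-reverse {u} (cons {d = d} {ds = ds} s≡u w) =
    subst (Walk T _ u) (sym (unfold-reverse (flip d) (map flip ds)))
      (walk-++ (walk-reverse w) (walk-single (flip d) (start-flip d) (trans (end-flip d) s≡u)))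

  vertices-reverse : ∀ {u v p} → Walk T u v p → vertices v (reversePath p) ≡ reverse (vertices u p)
  vertices-reverse nil = refl
  vertices-reverse {u} {v} (cons {d = d} {ds = ds} s≡u w) = begin
    v ∷ map (end T) (reverse (flip d ∷ map flip ds))
      ≡⟨ cong (λ z → v ∷ map (end T) z) (unfold-reverse (flip d) (map flip ds)) ⟩
    v ∷ map (end T) (reversePath ds ∷ʳ flip d)
      ≡⟨ cong (v ∷_) (map-++ (end T) (reversePath ds) (flip d ∷ [])) ⟩
    vertices v (reversePath ds) ∷ʳ end T (flip d)
      ≡⟨ cong₂ _∷ʳ_ (vertices-reverse w) (trans (end-flip d) s≡u) ⟩
    reverse (vertices (end T d) ds) ∷ʳ u
      ≡⟨ unfold-reverse u (vertices (end T d) ds) ⟨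
    reverse (vertices u (d ∷ ds))
      ∎
    where open ≡-Reasoning

  end-∈-laterVerts : ∀ {u v d ds} → Walk T u v (d ∷ ds) → v ∈ laterVerts T (d ∷ ds)
  end-∈-laterVerts (cons _ nil)            = here refl
  end-∈-laterVerts (cons _ w@(cons _ _)) = there (end-∈-laterVerts w)

  end-∈-vertices : ∀ {u v p} → Walk T u v p → v ∈ vertices u p
  end-∈-vertices nil            = here refl
  end-∈-vertices w@(cons _ _) = there (end-∈-laterVerts w)

  incident-∈-vertices : ∀ {x y r d z} → Walk T x y r → d ∈ r → Incident z (proj₁ d)
    → z ∈ vertices x r
  incident-∈-vertices (cons {d = d} s≡x _) (here refl) inc with incident⇒start⊎end d inc
  ... | inj₁ z≡s = here (trans z≡s s≡x)
  ... | inj₂ z≡e = there (here z≡e)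
  incident-∈-vertices (cons _ w) (there d∈) inc = there (incident-∈-vertices w d∈ inc)

  simplePath-++⁻ : ∀ p {q u w} → SimplePath T u w (p ++ q)
    → ∃ λ v → SimplePath T u v p × SimplePath T v w q
  simplePath-++⁻ p {q} {u} (wpq , unique) with walk-++⁻ p wpq
  ... | v , wp , wq
    with Unique-++⁻ (vertices u p) (subst Unique (cong (u ∷_) (map-++ (end T) p q)) unique)
  ...   | unique-p , unique-q , disjoint =
    v , (wp , unique-p)
      , (wq , All.¬Any⇒All¬ _ (λ v∈ → disjoint (end-∈-vertices wp , v∈)) ∷ unique-q)

  simplePath-∷ʳ⁻ : ∀ p {e u v} → SimplePath T u v (p ∷ʳ e)
    → SimplePath T u (start T e) p × end T e ≡ v
  simplePath-∷ʳ⁻ p sp with simplePath-++⁻ p sp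
  ... | _ , spₚ , (cons refl nil , _) = spₚ , refl

  simplePath-infix : ∀ a s r {u w} → SimplePath T u w (a ++ s ++ r)
    → ∃₂ λ x y → SimplePath T x y s
  simplePath-infix a s r sp with simplePath-++⁻ a sp
  ... | _ , _ , sp' with simplePath-++⁻ s sp'
  ...   | _ , spₛ , _ = _ , _ , spₛ

  simplePath-reverse : ∀ {u v p} → SimplePath T u v p → SimplePath T v u (reversePath p)
  simplePath-reverse (w , unique) =
    walk-reverse w , subst Unique (sym (vertices-reverse w)) (Unique-reverse unique)

  simplePath-closed : ∀ {u p} → SimplePath T u u p → p ≡ []
  simplePath-closed {p = []}    _           = refl
  simplePath-closed {p = _ ∷ _} (w , unique) =
    ⊥-elim (Unique[x∷xs]⇒x∉xs unique (end-∈-laterVerts w))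

  simplePath-loopFree : ∀ {x y r d} → SimplePath T x y r → d ∈ r → start T d ≢ end T d
  simplePath-loopFree (cons s≡x _ , unique) (here refl) s≡e =
    Unique[x∷xs]⇒x∉xs unique (here (trans (sym s≡x) s≡e))
  simplePath-loopFree (cons _ w , _ ∷ unique) (there d∈) = simplePath-loopFree (w , unique) d∈

  simplePath-indices-unique : ∀ {u v p} → SimplePath T u v p → Unique (map proj₁ p)
  simplePath-indices-unique (nil , _) = []
  simplePath-indices-unique {u} (cons {d = d} s≡u w , unique) =
    All.¬Any⇒All¬ _ repeated ∷ simplePath-indices-unique (w , AllPairs.tail unique)
    where
    u-incident : Incident u (proj₁ d)
    u-incident = subst (λ z → Incident z (proj₁ d)) s≡u (start-incident d)
    repeated : proj₁ d ∉ map proj₁ _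
    repeated i∈ with ∈-map⁻ proj₁ i∈
    ... | d' , d'∈ , i≡ =
      Unique[x∷xs]⇒x∉xs unique (incident-∈-vertices w d'∈ (subst (Incident u) i≡ u-incident))

  simplePath-single : ∀ {u w a f} → SimplePath T u w a → f ∈ a
    → (∀ {z} → Incident z (proj₁ f) → z ≡ u ⊎ z ≡ w) → a ≡ f ∷ []
  simplePath-single (cons {d = d} _ rest , unique) (here refl) endpoints
    with endpoints (end-incident d)
  ... | inj₁ e≡u = ⊥-elim (Unique[x∷xs]⇒x∉xs unique (here (sym e≡u)))
  ... | inj₂ refl = cong (d ∷_) (simplePath-closed (rest , AllPairs.tail unique))
  simplePath-single {w = w} {f = f} (cons _ rest , unique) (there f∈) endpoints =
    ⊥-elim (simplePath-loopFree (rest , AllPairs.tail unique) f∈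
      (trans (at-end (start-incident f)) (sym (at-end (end-incident f)))))
    where
    at-end : ∀ {z} → Incident z (proj₁ f) → z ≡ w
    at-end inc with endpoints inc
    ... | inj₁ refl = ⊥-elim (Unique[x∷xs]⇒x∉xs unique (incident-∈-vertices rest f∈ inc))
    ... | inj₂ z≡w  = z≡w

  simplePath-nonEmpty : ∀ {u w a b} → SimplePath T u w a → SimplePath T u w b → a ≢ b
    → NonEmpty T a
  simplePath-nonEmpty (nil , _)      pb a≢b = ⊥-elim (a≢b (sym (simplePath-closed pb)))
  simplePath-nonEmpty (cons _ _ , _) _  _   = nonEmpty

  cycle-of-paths : ∀ {u w a b} → SimplePath T u w a → SimplePath T u w b → a ≢ b
    → (∀ {z} → z ∈ laterVerts T a → z ∈ laterVerts T b → z ≡ w)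
    → Cycle T (a ++ reversePath b)
  cycle-of-paths {u} {w} {a} {b} pa@(wa , uniqueₐ) pb@(wb , _) a≢b meet =
    u , walk-++ wa (walk-reverse wb) , nonEmpty-++ (simplePath-nonEmpty pa pb a≢b)
      , indices-unique , laterVerts-unique
    where
    nonEmpty-++ : ∀ {xs ys : List (OEdge m)} → NonEmpty T xs → NonEmpty T (xs ++ ys)
    nonEmpty-++ nonEmpty = nonEmpty

    common : ∀ {z} → z ∈ vertices u a → z ∈ vertices u b → z ≡ u ⊎ z ≡ w
    common (here z≡u) _          = inj₁ z≡u
    common (there _)  (here z≡u) = inj₁ z≡u
    common (there za) (there zb) = inj₂ (meet za zb)

    shared-index : Disjoint (map proj₁ a) (reverse (map proj₁ b))
    shared-index (i∈a , i∈b) with ∈-map⁻ proj₁ i∈a | ∈-map⁻ proj₁ (Any.reverse⁻ i∈b)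
    ... | f , f∈ , refl | g , g∈ , f~g = a≢b (trans a≡f (trans (cong (_∷ []) f≡g) (sym b≡g)))
      where
      endpoints : ∀ {z} → Incident z (proj₁ f) → z ≡ u ⊎ z ≡ w
      endpoints inc = common (incident-∈-vertices wa f∈ inc)
                             (incident-∈-vertices wb g∈ (subst (Incident _) f~g inc))
      a≡f : a ≡ f ∷ []
      a≡f = simplePath-single pa f∈ endpoints
      b≡g : b ≡ g ∷ []
      b≡g = simplePath-single pb g∈ (endpoints ∘ subst (Incident _) (sym f~g))
      f≡g : f ≡ g
      f≡g = same-index-same-start f~g
        (trans (walk-start (subst (Walk T u w) a≡f wa))
               (sym (walk-start (subst (Walk T u w) b≡g wb))))
        (simplePath-loopFree pa f∈)

    indices-unique : Unique (map proj₁ (a ++ reversePath b))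
    indices-unique =
      subst Unique (sym (trans (map-++ proj₁ a (reversePath b))
                               (cong (map proj₁ a ++_) (indices-reversePath b))))
        (Unique.++⁺ (simplePath-indices-unique pa) (Unique-reverse (simplePath-indices-unique pb))
                    shared-index)

    uniqueʳ : Unique (vertices w (reversePath b))
    uniqueʳ = proj₂ (simplePath-reverse pb)

    shared-vertex : Disjoint (laterVerts T a) (laterVerts T (reversePath b))
    shared-vertex (za , zr)
      with common (there za) (Any.reverse⁻ (subst (_ ∈_) (vertices-reverse wb) (there zr)))
    ... | inj₁ refl = Unique[x∷xs]⇒x∉xs uniqueₐ za
    ... | inj₂ refl = Unique[x∷xs]⇒x∉xs uniqueʳ zr

    laterVerts-unique : Unique (laterVerts T (a ++ reversePath b))
    laterVerts-unique = subst Unique (sym (map-++ (end T) a (reversePath b)))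
      (Unique.++⁺ (AllPairs.tail uniqueₐ) (AllPairs.tail uniqueʳ) shared-vertex)

  simplePath-prefix : ∀ {u v} a e r → SimplePath T u v (a ++ e ∷ r)
    → SimplePath T u (end T e) (a ∷ʳ e)
  simplePath-prefix {u} {v} a e r sp
    with simplePath-++⁻ (a ∷ʳ e) (subst (SimplePath T u v) (sym (∷ʳ-++ a e r)) sp)
  ... | _ , spₐ , _ with simplePath-∷ʳ⁻ a spₐ
  ...   | _ , refl = spₐ

  -- The cycle is cut out at the first vertex of the first path that lies on the second one.
  diverging-paths⇒cycle : ∀ {u v d d' p q} → SimplePath T u v (d ∷ p) → SimplePath T u v (d' ∷ q)
    → d ≢ d' → ∃ (Cycle T)
  diverging-paths⇒cycle {u} {v} {d} {d'} {p} {q} sp@(wp , _) sq@(wq , _) d≢d'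
    with first-∃++ {P = λ x → end T x ∈ laterVerts T (d' ∷ q)}
                   (λ x → end T x ∈? laterVerts T (d' ∷ q))
                   (Any.map⁻ (lose (end-∈-laterVerts wp) (end-∈-laterVerts wq)))
  ... | a , e , r , p≡ , missₐ , e-hits with ∈-map⁻ (end T) e-hits
  ...   | e' , e'∈ , e~e' with ∈-∃++ e'∈
  ...     | b , r' , q≡ = _ , cycle-of-paths pa pb a≢b meet
    where
    pa : SimplePath T u (end T e) (a ∷ʳ e)
    pa = simplePath-prefix a e r (subst (SimplePath T u v) p≡ sp)
    pb : SimplePath T u (end T e) (b ∷ʳ e')
    pb = subst (λ z → SimplePath T u z _) (sym e~e')
               (simplePath-prefix b e' r' (subst (SimplePath T u v) q≡ sq))

    a≢b : a ∷ʳ e ≢ b ∷ʳ e'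
    a≢b a≡b = d≢d' (∷-≡-++-head (a ∷ʳ e) (trans p≡ (sym (∷ʳ-++ a e r)))
      (trans q≡ (trans (sym (∷ʳ-++ b e' r')) (cong (_++ r') (sym a≡b))))
      (λ eq → case ++-conicalʳ a (e ∷ []) eq of λ ()))

    in-q : ∀ {z} → z ∈ laterVerts T (b ∷ʳ e') → z ∈ laterVerts T (d' ∷ q)
    in-q z∈ = subst (λ xs → _ ∈ laterVerts T xs) (sym (trans q≡ (sym (∷ʳ-++ b e' r'))))
      (subst (_ ∈_) (sym (map-++ (end T) (b ∷ʳ e') r')) (∈-++⁺ˡ z∈))

    meet : ∀ {z} → z ∈ laterVerts T (a ∷ʳ e) → z ∈ laterVerts T (b ∷ʳ e') → z ≡ end T e
    meet z∈a z∈b with ∈-++⁻ (map (end T) a) (subst (_ ∈_) (map-++ (end T) a (e ∷ [])) z∈a)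
    ... | inj₁ z∈ =
      ⊥-elim (All.lookup (All.map⁺ {P = _∉ laterVerts T (d' ∷ q)} missₐ) z∈ (in-q z∈b))
    ... | inj₂ (here z≡e) = z≡e

  simplePath-unique : Acyclic T → ∀ {u v p q} → SimplePath T u v p → SimplePath T u v q → p ≡ q
  simplePath-unique _ {p = []} (nil , _) sq = sym (simplePath-closed sq)
  simplePath-unique _ {p = _ ∷ _} {q = []} sp (nil , _) = simplePath-closed sp
  simplePath-unique acyclic {p = d ∷ _} {q = d' ∷ _} sp@(cons _ wp , up) sq@(cons _ wq , uq)
    with d ≟ₑ d'
  ... | yes refl =
    cong (d ∷_) (simplePath-unique acyclic (wp , AllPairs.tail up) (wq , AllPairs.tail uq))
  ... | no d≢d' = ⊥-elim (uncurry acyclic (diverging-paths⇒cycle sp sq d≢d'))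

  start-opposite : ∀ {i b b'} → b ≢ b' → start T (i , b') ≡ end T (i , b)
  start-opposite {b = true}  {true}  b≢b' = ⊥-elim (b≢b' refl)
  start-opposite {b = true}  {false} _    = refl
  start-opposite {b = false} {true}  _    = refl
  start-opposite {b = false} {false} b≢b' = ⊥-elim (b≢b' refl)

  simplePath-end : ∀ p {e u v} → SimplePath T u v (p ∷ʳ e) → end T e ≡ v
  simplePath-end p sp = proj₂ (simplePath-∷ʳ⁻ p sp)

  simplePath-reverse-∷-∷ʳ : ∀ {u v d q e} → SimplePath T u v (d ∷ q ∷ʳ e)
    → SimplePath T v u (flip e ∷ reversePath q ∷ʳ flip d)
  simplePath-reverse-∷-∷ʳ {d = d} {q} {e} sp =
    subst (SimplePath T _ _) (reversePath-∷-∷ʳ d q e) (simplePath-reverse sp)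

  -- If the orientations of f_k differed, the rest of the first path would run from the
  -- start of the second one to f_l and so, by uniqueness, would have to pass through f_k again.
  start-orientation-unique : Acyclic T → ∀ {s t u v k l b c b' c' q q'}
    → SimplePath T s t ((k , b) ∷ q ∷ʳ (l , c)) → SimplePath T u v ((k , b') ∷ q' ∷ʳ (l , c'))
    → b ≡ b'
  start-orientation-unique acyclic {t = t} {u} {k = k} {l} {b} {c} {b'} {c'} {q} {q'}
                           sS@(cons _ wR , uniqueS) sγ@(wγ , _) with b ≟ᵇ b'
  ... | yes b≡b' = b≡b'
  ... | no b≢b' = ⊥-elim (Unique[x∷xs]⇒x∉xs (simplePath-indices-unique sS)
                           (subst (λ xs → k ∈ map proj₁ xs) (sym (proj₂ rest≡)) (here refl)))
    where
    rest : SimplePath T u t (q ∷ʳ (l , c))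
    rest = subst (λ z → SimplePath T z t _) (trans (sym (start-opposite b≢b')) (walk-start wγ))
                 (wR , AllPairs.tail uniqueS)
    t-end : end T (l , c) ≡ t
    t-end = simplePath-end ((k , b) ∷ q) sS
    rest≡ : ∃ λ g → q ∷ʳ (l , c) ≡ (k , b') ∷ g
    rest≡ with c ≟ᵇ c'
    ... | yes refl = _ , simplePath-unique acyclic rest
                           (subst (λ z → SimplePath T u z _)
                                  (trans (sym (simplePath-end ((k , b') ∷ q') sγ)) t-end) sγ)
    ... | no c≢c' = q' , simplePath-unique acyclic rest
                           (subst (λ z → SimplePath T u z _) (trans (start-opposite c≢c') t-end)
                                  (proj₁ (simplePath-∷ʳ⁻ ((k , b') ∷ q') sγ)))

  edge-to-edge-path-unique : Acyclic T → ∀ {s t u v k l b c b' c' q q'}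
    → SimplePath T s t ((k , b) ∷ q ∷ʳ (l , c)) → SimplePath T u v ((k , b') ∷ q' ∷ʳ (l , c'))
    → (k , b) ∷ q ∷ʳ (l , c) ≡ (k , b') ∷ q' ∷ʳ (l , c')
  edge-to-edge-path-unique acyclic {k = k} {b = b} {q = q} {q' = q'} sS@(wS , _) sγ@(wγ , _)
    with start-orientation-unique acyclic sS sγ
       | not-injective (start-orientation-unique acyclic (simplePath-reverse-∷-∷ʳ sS)
                                                         (simplePath-reverse-∷-∷ʳ sγ))
  ... | refl | refl = simplePath-unique acyclic sS
    (subst₂ (λ x y → SimplePath T x y _) (trans (sym (walk-start wγ)) (walk-start wS))
            (trans (sym (simplePath-end ((k , b) ∷ q') sγ)) (simplePath-end ((k , b) ∷ q) sS)) sγ)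

  Sign-along : ∀ {s t k l b c q} → SimplePath T s t ((k , b) ∷ q ∷ʳ (l , c))
    → Sign k l ((k , b) ∷ q ∷ʳ (l , c)) ≡ sgn b * sgn c
  Sign-along {q = q} sp =
    cong₂ _*_ (coef-∈ _ unique (here refl)) (coef-∈ _ unique (there (∈-++⁺ʳ q (here refl))))
    where unique = simplePath-indices-unique sp

  -- The edges f_k, f_l of P bound a segment of P, which is γ or its reverse.
  coef-product-along-path : Acyclic T → ∀ {k l γ x y P} → k ≢ l → PathFromEdgeToEdge T k l γ
    → SimplePath T x y P → coef k P ≢ 0ℤ → coef l P ≢ 0ℤ → coef k P * coef l P ≡ Sign k l γ
  coef-product-along-path acyclic k≢l (_ , _ , _ , first , last) = ⊥-elim (k≢l refl)
  coef-product-along-path acyclic {k} {l} {γ} {x} {y} {P} k≢l (_ , _ , sγ , first , later lastₗ)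
                          sP coefₖ≢0 coefₗ≢0
    with LastEdge⇒∷ʳ lastₗ | coef≢0⇒∈ P coefₖ≢0 | coef≢0⇒∈ P coefₗ≢0
  ... | _ , _ , refl | b , kb∈ | c , lc∈ = begin
    coef k P * coef l P  ≡⟨ cong₂ _*_ (coef-∈ P uniqueP kb∈) (coef-∈ P uniqueP lc∈) ⟩
    sgn b * sgn c        ≡⟨ segment-sign (∈-∈-∃++ kb∈ lc∈ (k≢l ∘ cong proj₁)) ⟩
    Sign k l γ           ∎
    where
    open ≡-Reasoning
    uniqueP = simplePath-indices-unique sP

    segment : ∀ a s r → P ≡ a ++ s ++ r → ∃₂ λ x' y' → SimplePath T x' y' s
    segment a s r P≡ = simplePath-infix a s r (subst (SimplePath T x y) P≡ sP)

    segment-sign : (∃₂ λ a q → ∃ λ r → P ≡ a ++ ((k , b) ∷ q ∷ʳ (l , c)) ++ r)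
                 ⊎ (∃₂ λ a q → ∃ λ r → P ≡ a ++ ((l , c) ∷ q ∷ʳ (k , b)) ++ r)
                 → sgn b * sgn c ≡ Sign k l γ
    segment-sign (inj₁ (a , q , r , P≡)) with segment a _ r P≡
    ... | _ , _ , sS =
      trans (sym (Sign-along sS)) (cong (Sign k l) (edge-to-edge-path-unique acyclic sS sγ))
    segment-sign (inj₂ (a , q , r , P≡)) with segment a _ r P≡
    ... | _ , _ , sS =
      trans (sym (sgn-not-* b c))
            (trans (sym (Sign-along sR)) (cong (Sign k l) (edge-to-edge-path-unique acyclic sR sγ)))
      where sR = simplePath-reverse-∷-∷ʳ sS

theorem6 : (n M N : ℕ) (T₀ : EdgeSet n M) (E : EdgeSet n N)
    → IsSpanningTree T₀
    → (D : Fin N → List (OEdge M))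
    → (∀ e → SimplePath T₀ (proj₂ (E e)) (proj₁ (E e)) (D e))
    → ((k : Fin M) → YYt D k k ≡ + countSupp D k)
      × ((k l : Fin M) → k ≢ l → (γ : List (OEdge M)) → PathFromEdgeToEdge T₀ k l γ
         → YYt D k l ≡ Sign k l γ * + countSupp₂ D k l)
theorem6 n M N T₀ E (_ , acyclic) D paths = diagonal , off-diagonal
  where
  open Paths T₀

  diagonal : (k : Fin M) → YYt D k k ≡ + countSupp D k
  diagonal k = trans (sum-indicator _ _ 1ℤ square (λ e vanishes → product-≡0 _ _ (vanishes ∘ proj₁))
                                    (allFin N))
                     (*-identityˡ _)
    where
    square : ∀ e → coef k (D e) ≢ 0ℤ → coef k (D e) * coef k (D e) ≡ 1ℤ
    square e coef≢0 with coef≢0⇒∈ (D e) coef≢0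
    ... | b , kb∈ =
      trans (cong (λ z → z * z) (coef-∈ (D e) (simplePath-indices-unique (paths e)) kb∈))
            (sgn-square b)

  off-diagonal : (k l : Fin M) → k ≢ l → (γ : List (OEdge M)) → PathFromEdgeToEdge T₀ k l γ
    → YYt D k l ≡ Sign k l γ * + countSupp₂ D k l
  off-diagonal k l k≢l γ pγ = sum-indicator _ _ (Sign k l γ)
    (λ e (coefₖ≢0 , coefₗ≢0) → coef-product-along-path acyclic k≢l pγ (paths e) coefₖ≢0 coefₗ≢0)
    (λ e → product-≡0 _ _) (allFin N)
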